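{- Let $p$ be a prime, let $s \geq 2$ be an integer, let $\alpha, \beta$ be non-negative integers with $\alpha, \beta < p^{s-1}$, and let $r, l$ be integers with $1 \leq r, l < p$. Then: (1) $\displaystyle \binom{\alpha + p^s}{\beta + l p^{s-1}} \equiv \binom{\alpha}{\beta}\binom{p}{l} \pmod{p^2}$; (2) if $l \leq r$, then $$\binom{\alpha + r p^{s-1} + p^s}{\beta + l p^{s-1}} \equiv \binom{\alpha + r p^{s-1}}{\beta + l p^{s-1}} + \sum_{j=1}^{l} \binom{\alpha + r p^{s-1}}{\beta + (l-j) p^{s-1}}\binom{p}{j} \pmod{p^2},$$ and if $l > r$, then $$\binom{\alpha + r p^{s-1} + p^s}{\beta + l p^{s-1}} \equiv \sum_{j=l-r}^{l} \binom{\alpha + r p^{s-1}}{\beta + (l-j) p^{s-1}}\binom{p}{j} \pmod{p^2};$$ (3) if $l < r$, then $$\binom{\alpha + r p^{s-1} + p^s}{\beta + l p^{s-1} + p^s} \equiv \binom{\alpha + r p^{s-1}}{\beta + l p^{s-1}} + \sum_{j=1}^{r-l} \binom{\alpha + r p^{s-1}}{\beta + (l+j) p^{s-1}}\binom{p}{j} \pmod{p^2},$$ and if $l = r$, then $$\binom{\alpha + r p^{s-1} + p^s}{\beta + l p^{s-1} + p^s} \equiv \binom{\alpha + r p^{s-1}}{\beta + l p^{s-1}} \pmod{p^2}.$$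
   Context: Binomial coefficients $\binom{n}{k}$ with integers $0\le n$ and $k>n$ or $k<0$ are taken to be $0$. -}

module Defs where

open import Data.Nat using (ℕ; zero; suc; _+_; _∸_)
import Data.Integer as ℤ
open import Data.Integer.Divisibility using (_∣_)

infix 4 _≋_[mod_]
_≋_[mod_] : ℕ → ℕ → ℕ → Set
a ≋ b [mod m ] = ℤ.+ m ∣ (ℤ.+ a ℤ.- ℤ.+ b)

sumFrom : ℕ → ℕ → (ℕ → ℕ) → ℕ
sumFrom a zero    f = 0
sumFrom a (suc n) f = f a + sumFrom (suc a) n f

-- ∑_{j=a}^{b} f j  (empty when b < a)
sumRange : ℕ → ℕ → (ℕ → ℕ) → ℕ
sumRange a b f = sumFrom a (suc b ∸ a) f

module Submission where

-- Over any commutative semiring, (u + 1)^p ≡ u^p + 1 modulo p because p divides the middle binomial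
-- coefficients; iterating, (u + 1)^(p^t) ≡ u^(p^t) + 1 modulo p, and since a ≡ b (mod n) implies
-- a^n ≡ b^n (mod n²), (u + 1)^(p^(t+1)) ≡ (u^(p^t) + 1)^p modulo p².  In ℕ[x], multiplying by (1 + x)^A
-- and comparing the coefficients of x^K gives
--   C(A + p^(t+1), K) ≡ ∑_{k ≤ p} C(p, k) C(A, K − k p^t)   (mod p²),
-- and the same with p − k in place of k when (x^(p^t) + 1)^p is expanded the other way round.
-- For A = α + r p^t and K = β + l p^t (or K = β + l p^t + p^(t+1)) with α, β < p^t, the coefficient
-- C(A, β + j p^t) vanishes as soon as j > r, and C(A, K − k p^t) is read as 0 when K < k p^t; this
-- cuts the sum down to the range in the statement.

open import Level using (0ℓ; _⊔_)
open import Algebra.Bundles using (CommutativeSemiring)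
open import Data.Nat as ℕ using (ℕ; zero; suc; z≤n; s≤s)
import Data.Nat.Properties as ℕ
open import Data.Nat.Combinatorics
  using (_C_; nCn≡1; nC1≡n; nCk+nC[k+1]≡[n+1]C[k+1]; nCk≡nC[n∸k]; k>n⇒nCk≡0)
open import Data.Nat.Divisibility using (_∣_; divides; ∣⇒≤; m∣m*n)
open import Data.Nat.Primality using (Prime; euclidsLemma)
open import Data.Sum using (inj₁; inj₂)
open import Data.Fin using (toℕ)
open import Data.Empty using (⊥-elim)
open import Relation.Binary.PropositionalEquality as ≡ using (_≡_)

-- Divisibility of binomial coefficients

module PrimeBinomial where

  open import Data.Nat using (_+_; _*_; _<_)
  open import Data.Nat.Properties
  open ≡ using (refl; cong; cong₂; trans; sym)
  open ≡.≡-Reasoning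

  [k+1]*[n+1]C[k+1]≡[n+1]*nCk : ∀ n k → suc k * (suc n C suc k) ≡ suc n * (n C k)
  [k+1]*[n+1]C[k+1]≡[n+1]*nCk zero    zero    = refl
  [k+1]*[n+1]C[k+1]≡[n+1]*nCk zero    (suc k) = *-zeroʳ (suc (suc k))
  [k+1]*[n+1]C[k+1]≡[n+1]*nCk (suc n) zero    =
    trans (+-identityʳ _) (trans (nC1≡n (suc (suc n))) (sym (*-identityʳ (suc (suc n)))))
  [k+1]*[n+1]C[k+1]≡[n+1]*nCk (suc n) (suc k) = begin
    suc (suc k) * (suc (suc n) C suc (suc k))
      ≡⟨ cong (suc (suc k) *_) (nCk+nC[k+1]≡[n+1]C[k+1] (suc n) (suc k)) ⟨
    suc (suc k) * (a + b)
      ≡⟨ *-distribˡ-+ (suc (suc k)) a b ⟩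
    (a + suc k * a) + suc (suc k) * b
      ≡⟨ cong₂ (λ x y → (a + x) + y) ([k+1]*[n+1]C[k+1]≡[n+1]*nCk n k) ([k+1]*[n+1]C[k+1]≡[n+1]*nCk n (suc k)) ⟩
    (a + suc n * (n C k)) + suc n * (n C suc k)
      ≡⟨ +-assoc a _ _ ⟩
    a + (suc n * (n C k) + suc n * (n C suc k))
      ≡⟨ cong (a +_) (*-distribˡ-+ (suc n) (n C k) (n C suc k)) ⟨
    a + suc n * (n C k + n C suc k)
      ≡⟨ cong (λ z → a + suc n * z) (nCk+nC[k+1]≡[n+1]C[k+1] n k) ⟩
    a + suc n * a
      ∎
    where
      a = suc n C suc k
      b = suc n C suc (suc k)

  p∣pCk : ∀ {p k} → Prime p → 0 < k → k < p → p ∣ p C k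
  p∣pCk {suc n} {suc k} pr _ k<p
    with euclidsLemma (suc k) (suc n C suc k) pr
           (divides (n C k) (trans ([k+1]*[n+1]C[k+1]≡[n+1]*nCk n k) (*-comm (suc n) (n C k))))
  ... | inj₂ p∣C   = p∣C
  ... | inj₁ p∣k+1 = ⊥-elim (<⇒≱ k<p (∣⇒≤ p∣k+1))

open PrimeBinomial using (p∣pCk)

-- Congruences in a commutative semiring

module Congruence {c ℓ} (R : CommutativeSemiring c ℓ) where

  open CommutativeSemiring R
  open import Algebra.Properties.Semiring.Exp semiring using (_^_; ^-congˡ; ^-congʳ; ^-assocʳ)
  open import Algebra.Properties.Semiring.Mult semiring
    using (_×_; ×-congʳ; ×-congˡ; ×-assoc-*; ×-homo-1; ×-assocˡ)
  open import Algebra.Properties.CommutativeSemiring.Binomial R using () renaming (theorem to binomial-theorem)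
  open import Algebra.Properties.Monoid.Sum +-monoid using (sum)
  open import Algebra.Solver.Ring.NaturalCoefficients.Default R
  open import Relation.Binary.Reasoning.Setoid setoid

  infix 4 _≈_mod_
  record _≈_mod_ (x y q : Carrier) : Set (c ⊔ ℓ) where
    constructor witness
    field
      multiplier : Carrier
      equation   : x ≈ y + q * multiplier

  ≈⇒≈mod : ∀ {x y q} → x ≈ y → x ≈ y mod q
  ≈⇒≈mod {x} {y} {q} x≈y = witness 0# (begin
    x           ≈⟨ x≈y ⟩
    y           ≈⟨ +-identityʳ y ⟨
    y + 0#      ≈⟨ +-congˡ (zeroʳ q) ⟨
    y + q * 0#  ∎)

  mod-trans : ∀ {x y z q} → x ≈ y mod q → y ≈ z mod q → x ≈ z mod q
  mod-trans {x} {y} {z} {q} (witness e x≈y+qe) (witness e′ y≈z+qe′) = witness (e′ + e) (begin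
    x                       ≈⟨ x≈y+qe ⟩
    y + q * e               ≈⟨ +-congʳ y≈z+qe′ ⟩
    (z + q * e′) + q * e    ≈⟨ solve 4 (λ z q e e′ → (z :+ q :* e′) :+ q :* e := z :+ q :* (e′ :+ e))
                                       refl z q e e′ ⟩
    z + q * (e′ + e)        ∎)

  mod-+-cong : ∀ {x x′ y y′ q} → x ≈ x′ mod q → y ≈ y′ mod q → x + y ≈ x′ + y′ mod q
  mod-+-cong {x} {x′} {y} {y′} {q} (witness e x≈) (witness e′ y≈) = witness (e + e′) (begin
    x + y                           ≈⟨ +-cong x≈ y≈ ⟩
    (x′ + q * e) + (y′ + q * e′)
      ≈⟨ solve 5 (λ x′ y′ q e e′ → (x′ :+ q :* e) :+ (y′ :+ q :* e′) := (x′ :+ y′) :+ q :* (e :+ e′))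
               refl x′ y′ q e e′ ⟩
    (x′ + y′) + q * (e + e′)        ∎)

  mod-*-cong : ∀ {x x′ y y′ q} → x ≈ x′ mod q → y ≈ y′ mod q → x * y ≈ x′ * y′ mod q
  mod-*-cong {x} {x′} {y} {y′} {q} (witness e x≈) (witness e′ y≈) =
    witness (e * y′ + x′ * e′ + q * (e * e′)) (begin
    x * y                           ≈⟨ *-cong x≈ y≈ ⟩
    (x′ + q * e) * (y′ + q * e′)
      ≈⟨ solve 5 (λ x′ y′ q e e′ → (x′ :+ q :* e) :* (y′ :+ q :* e′)
                                  := x′ :* y′ :+ q :* (e :* y′ :+ x′ :* e′ :+ q :* (e :* e′)))
               refl x′ y′ q e e′ ⟩
    x′ * y′ + q * (e * y′ + x′ * e′ + q * (e * e′)) ∎)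

  mod-^-cong : ∀ {x y q} n → x ≈ y mod q → x ^ n ≈ y ^ n mod q
  mod-^-cong zero    x≈y = ≈⇒≈mod refl
  mod-^-cong (suc n) x≈y = mod-*-cong x≈y (mod-^-cong n x≈y)

  ^-suc-expansion : ∀ y q e n →
    (y + q * e) ^ suc n ≈ y ^ suc n + (suc n × 1#) * (q * (y ^ n * e)) mod q * q
  ^-suc-expansion y q e zero = ≈⇒≈mod (solve 3
    (λ y q e → (y :+ q :* e) :* con 1 := y :* con 1 :+ (con 1 :+ con 0) :* (q :* (con 1 :* e)))
    refl y q e)
  ^-suc-expansion y q e (suc n) with ^-suc-expansion y q e n
  ... | witness c ih = witness (M * (A * (e * e)) + (y + q * e) * c) (begin
    (y + q * e) * (y + q * e) ^ suc n
      ≈⟨ *-congˡ ih ⟩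
    (y + q * e) * ((y * A + M * (q * (A * e))) + (q * q) * c)
      ≈⟨ solve 6 (λ y q e A M c →
           (y :+ q :* e) :* ((y :* A :+ M :* (q :* (A :* e))) :+ (q :* q) :* c)
           := (y :* (y :* A) :+ (con 1 :+ M) :* (q :* ((y :* A) :* e)))
              :+ (q :* q) :* (M :* (A :* (e :* e)) :+ (y :+ q :* e) :* c))
           refl y q e A M c ⟩
    (y * (y * A) + (1# + M) * (q * ((y * A) * e))) + (q * q) * (M * (A * (e * e)) + (y + q * e) * c) ∎)
    where
      A = y ^ n
      M = suc n × 1#

  ^-lift-mod : ∀ {x y} n → x ≈ y mod (n × 1#) → x ^ n ≈ y ^ n mod (n × 1#) * (n × 1#)
  ^-lift-mod zero    _            = ≈⇒≈mod refl
  ^-lift-mod {x} {y} n@(suc k) (witness e x≈) with ^-suc-expansion y N e k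
    where N = n × 1#
  ... | witness c expansion = witness (y ^ k * e + c) (begin
    x ^ n                                       ≈⟨ ^-congˡ n x≈ ⟩
    (y + N * e) ^ n                             ≈⟨ expansion ⟩
    (y ^ n + N * (N * (y ^ k * e))) + (N * N) * c
      ≈⟨ solve 4 (λ Y N w c → (Y :+ N :* (N :* w)) :+ (N :* N) :* c := Y :+ (N :* N) :* (w :+ c))
               refl (y ^ n) N (y ^ k * e) c ⟩
    y ^ n + (N * N) * (y ^ k * e + c)           ∎)
    where N = n × 1#

  sumFromᴿ : ℕ → ℕ → (ℕ → Carrier) → Carrier
  sumFromᴿ a zero    f = 0#
  sumFromᴿ a (suc n) f = f a + sumFromᴿ (suc a) n f

  sumFromᴿ-suc : ∀ a n f → sumFromᴿ a n (λ i → f (suc i)) ≡ sumFromᴿ (suc a) n f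
  sumFromᴿ-suc a zero    f = ≡.refl
  sumFromᴿ-suc a (suc n) f = ≡.cong (f (suc a) +_) (sumFromᴿ-suc (suc a) n f)

  sum≈sumFromᴿ : ∀ n f → sum {n} (λ i → f (toℕ i)) ≈ sumFromᴿ 0 n f
  sum≈sumFromᴿ zero    f = refl
  sum≈sumFromᴿ (suc n) f = +-congˡ (trans (sum≈sumFromᴿ n (λ i → f (suc i))) (reflexive (sumFromᴿ-suc 0 n f)))

  binomial : ∀ x y n → (x + y) ^ n ≈ sumFromᴿ 0 (suc n) (λ k → (n C k) × (x ^ k * y ^ (n ℕ.∸ k)))
  binomial x y n = trans (binomial-theorem n x y) (sum≈sumFromᴿ (suc n) (λ k → (n C k) × (x ^ k * y ^ (n ℕ.∸ k))))

  sumFromᴿ-cong : ∀ a n {f g} → (∀ k → f k ≈ g k) → sumFromᴿ a n f ≈ sumFromᴿ a n g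
  sumFromᴿ-cong a zero    f≈g = refl
  sumFromᴿ-cong a (suc n) f≈g = +-cong (f≈g a) (sumFromᴿ-cong (suc a) n f≈g)

  sumFromᴿ-snoc : ∀ a n f → sumFromᴿ a (suc n) f ≈ sumFromᴿ a n f + f (a ℕ.+ n)
  sumFromᴿ-snoc a zero    f = trans (+-comm _ _) (+-congˡ (reflexive (≡.cong f (≡.sym (ℕ.+-identityʳ a)))))
  sumFromᴿ-snoc a (suc n) f = begin
    f a + sumFromᴿ (suc a) (suc n) f        ≈⟨ +-congˡ (sumFromᴿ-snoc (suc a) n f) ⟩
    f a + (sumFromᴿ (suc a) n f + f (suc a ℕ.+ n)) ≈⟨ +-assoc _ _ _ ⟨
    (f a + sumFromᴿ (suc a) n f) + f (suc a ℕ.+ n) ≈⟨ +-congˡ (reflexive (≡.cong f (≡.sym (ℕ.+-suc a n)))) ⟩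
    (f a + sumFromᴿ (suc a) n f) + f (a ℕ.+ suc n) ∎

  sumFromᴿ-≈0mod : ∀ {q} a n f → (∀ k → a ℕ.≤ k → k ℕ.< a ℕ.+ n → f k ≈ 0# mod q) → sumFromᴿ a n f ≈ 0# mod q
  sumFromᴿ-≈0mod a zero    f f≈0 = ≈⇒≈mod refl
  sumFromᴿ-≈0mod a (suc n) f f≈0 = mod-trans
    (mod-+-cong (f≈0 a ℕ.≤-refl (ℕ.m<m+n a (s≤s z≤n)))
      (sumFromᴿ-≈0mod (suc a) n f λ k a<k k< →
        f≈0 k (ℕ.<⇒≤ a<k) (ℕ.<-≤-trans k< (ℕ.≤-reflexive (≡.sym (ℕ.+-suc a n))))))
    (≈⇒≈mod (+-identityʳ 0#))

  1#^n≈1# : ∀ n → 1# ^ n ≈ 1#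
  1#^n≈1# zero    = refl
  1#^n≈1# (suc n) = trans (*-identityˡ _) (1#^n≈1# n)

  ×≈×1#* : ∀ n x → n × x ≈ (n × 1#) * x
  ×≈×1#* n x = trans (×-congʳ n (sym (*-identityˡ x))) (sym (×-assoc-* n 1# x))

  frobenius : ∀ {p} → Prime p → ∀ u → (u + 1#) ^ p ≈ u ^ p + 1# mod (p × 1#)
  frobenius {suc p′} pr u = mod-trans (≈⇒≈mod expand) (mod-trans
    (mod-+-cong (≈⇒≈mod first) (mod-+-cong (sumFromᴿ-≈0mod 1 p′ t middle) (≈⇒≈mod last)))
    (≈⇒≈mod (solve 2 (λ x y → x :+ (con 0 :+ y) := y :+ x) refl 1# (u ^ p))))
    where
      p = suc p′
      t : ℕ → Carrier
      t k = (p C k) × (u ^ k * 1# ^ (p ℕ.∸ k))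
      expand : (u + 1#) ^ p ≈ t 0 + (sumFromᴿ 1 p′ t + t p)
      expand = trans (binomial u 1# p) (+-congˡ (sumFromᴿ-snoc 1 p′ t))
      first : t 0 ≈ 1#
      first = trans (×-homo-1 _) (trans (*-identityˡ _) (1#^n≈1# p))
      last : t p ≈ u ^ p
      last = trans (×-congˡ (nCn≡1 p)) (trans (×-homo-1 _)
               (trans (*-congˡ (^-congʳ 1# (ℕ.n∸n≡0 p))) (*-identityʳ _)))
      middle : ∀ k → 1 ℕ.≤ k → k ℕ.< 1 ℕ.+ p′ → t k ≈ 0# mod (p × 1#)
      middle k 0<k k<p with p∣pCk pr 0<k k<p
      ... | divides d pCk≡dp = witness (d × v) (begin
        (p C k) × v             ≈⟨ ×-congˡ pCk≡dp ⟩
        (d ℕ.* p) × v           ≈⟨ ×-congˡ (ℕ.*-comm d p) ⟩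
        (p ℕ.* d) × v           ≈⟨ ×-assocˡ v p d ⟨
        p × (d × v)             ≈⟨ ×≈×1#* p (d × v) ⟩
        (p × 1#) * (d × v)      ≈⟨ +-identityˡ _ ⟨
        0# + (p × 1#) * (d × v) ∎)
        where v = u ^ k * 1# ^ (p ℕ.∸ k)

  ^-^-suc : ∀ x p t → x ^ (p ℕ.^ suc t) ≈ (x ^ (p ℕ.^ t)) ^ p
  ^-^-suc x p t = trans (^-congʳ x (ℕ.*-comm p (p ℕ.^ t))) (sym (^-assocʳ x (p ℕ.^ t) p))

  frobenius-iterated : ∀ {p} → Prime p → ∀ u t → (u + 1#) ^ (p ℕ.^ t) ≈ u ^ (p ℕ.^ t) + 1# mod (p × 1#)
  frobenius-iterated {p} pr u zero    = ≈⇒≈mod (trans (*-identityʳ _) (+-congʳ (sym (*-identityʳ u))))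
  frobenius-iterated {p} pr u (suc t) =
    mod-trans (≈⇒≈mod (^-^-suc (u + 1#) p t))
    (mod-trans (mod-^-cong p (frobenius-iterated pr u t))
    (mod-trans (frobenius pr (u ^ (p ℕ.^ t)))
    (≈⇒≈mod (+-congʳ (sym (^-^-suc u p t))))))

  frobenius-mod-p² : ∀ {p} → Prime p → ∀ u t →
    (u + 1#) ^ (p ℕ.^ suc t) ≈ (u ^ (p ℕ.^ t) + 1#) ^ p mod (p × 1#) * (p × 1#)
  frobenius-mod-p² {p} pr u t =
    mod-trans (≈⇒≈mod (^-^-suc (u + 1#) p t)) (^-lift-mod p (frobenius-iterated pr u t))

  binomial-x^q+1 : ∀ x q n → (x ^ q + 1#) ^ n ≈ sumFromᴿ 0 (suc n) (λ k → (n C k) × x ^ (q ℕ.* k))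
  binomial-x^q+1 x q n = trans (binomial (x ^ q) 1# n) (sumFromᴿ-cong 0 (suc n) λ k →
    ×-congʳ (n C k) (trans (*-congˡ (1#^n≈1# (n ℕ.∸ k))) (trans (*-identityʳ _) (^-assocʳ x q k))))

  binomial-x^q+1-reversed : ∀ x q n → (x ^ q + 1#) ^ n ≈ sumFromᴿ 0 (suc n) (λ k → (n C k) × x ^ (q ℕ.* (n ℕ.∸ k)))
  binomial-x^q+1-reversed x q n = trans (^-congˡ n (+-comm (x ^ q) 1#)) (trans (binomial 1# (x ^ q) n)
    (sumFromᴿ-cong 0 (suc n) λ k →
      ×-congʳ (n C k) (trans (*-congʳ (1#^n≈1# k)) (trans (*-identityˡ _) (^-assocʳ x q (n ℕ.∸ k))))))

open import Defs
open import Data.Nat using (_+_; _*_; _∸_; _^_; _≤_; _<_; _>_)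
open import Data.Nat.Properties
open import Data.Nat.Tactic.RingSolver using (solve-∀)
import Data.Integer as ℤ
import Data.Integer.Properties as ℤ
open import Data.Product using (Σ; _×_; _,_)
open import Data.List using (List; []; _∷_)
open import Function using (_∘_; const)
open import Relation.Binary.PropositionalEquality
open import Relation.Binary.Structures using (IsEquivalence)
open import Algebra.Structures.Biased using (IsCommutativeSemiringˡ; isCommutativeMonoidˡ)
open import Algebra.Properties.CommutativeSemigroup +-commutativeSemigroup using (interchange; x∙yz≈y∙xz)

-- Polynomials with coefficients in ℕ

shift : ℕ → (ℕ → ℕ) → ℕ → ℕ
shift zero    g k       = g k
shift (suc m) g zero    = 0
shift (suc m) g (suc k) = shift m g k

shift-cong : ∀ m {g h} → g ≗ h → shift m g ≗ shift m h
shift-cong zero    g≗h k       = g≗h k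
shift-cong (suc m) g≗h zero    = refl
shift-cong (suc m) g≗h (suc k) = shift-cong m g≗h k

infixr 5 _∷ᶠ_
_∷ᶠ_ : ℕ → (ℕ → ℕ) → ℕ → ℕ
(b ∷ᶠ G) zero    = b
(b ∷ᶠ G) (suc i) = G i

conv : (ℕ → ℕ) → (ℕ → ℕ) → ℕ → ℕ
conv F G zero    = F 0 * G 0
conv F G (suc k) = F 0 * G (suc k) + conv (F ∘ suc) G k

conv-cong : ∀ {F F′ G G′} → F ≗ F′ → G ≗ G′ → conv F G ≗ conv F′ G′
conv-cong F≗F′ G≗G′ zero    = cong₂ _*_ (F≗F′ 0) (G≗G′ 0)
conv-cong F≗F′ G≗G′ (suc k) =
  cong₂ _+_ (cong₂ _*_ (F≗F′ 0) (G≗G′ (suc k))) (conv-cong (F≗F′ ∘ suc) G≗G′ k)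

conv-zeroˡ : ∀ G → conv (const 0) G ≗ const 0
conv-zeroˡ G zero    = refl
conv-zeroˡ G (suc k) = conv-zeroˡ G k

conv-zeroʳ : ∀ F → conv F (const 0) ≗ const 0
conv-zeroʳ F zero    = *-zeroʳ (F 0)
conv-zeroʳ F (suc k) = cong₂ _+_ (*-zeroʳ (F 0)) (conv-zeroʳ (F ∘ suc) k)

conv-distribʳ : ∀ F F′ G → conv (λ i → F i + F′ i) G ≗ λ k → conv F G k + conv F′ G k
conv-distribʳ F F′ G zero    = *-distribʳ-+ (G 0) (F 0) (F′ 0)
conv-distribʳ F F′ G (suc k) = begin
  (F 0 + F′ 0) * G (suc k) + conv (λ i → F (suc i) + F′ (suc i)) G k
    ≡⟨ cong₂ _+_ (*-distribʳ-+ (G (suc k)) (F 0) (F′ 0)) (conv-distribʳ (F ∘ suc) (F′ ∘ suc) G k) ⟩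
  (F 0 * G (suc k) + F′ 0 * G (suc k)) + (conv (F ∘ suc) G k + conv (F′ ∘ suc) G k)
    ≡⟨ interchange (F 0 * G (suc k)) (F′ 0 * G (suc k)) _ _ ⟩
  (F 0 * G (suc k) + conv (F ∘ suc) G k) + (F′ 0 * G (suc k) + conv (F′ ∘ suc) G k)
    ∎
  where open ≡-Reasoning

conv-scaleˡ : ∀ a F G → conv (λ i → a * F i) G ≗ λ k → a * conv F G k
conv-scaleˡ a F G zero    = *-assoc a (F 0) (G 0)
conv-scaleˡ a F G (suc k) =
  trans (cong₂ _+_ (*-assoc a (F 0) (G (suc k))) (conv-scaleˡ a (F ∘ suc) G k))
        (sym (*-distribˡ-+ a _ _))

conv-unfoldˡ : ∀ F G → conv F G ≗ λ k → F 0 * G k + (0 ∷ᶠ conv (F ∘ suc) G) k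
conv-unfoldˡ F G zero    = sym (+-identityʳ _)
conv-unfoldˡ F G (suc k) = refl

conv-unfoldʳ : ∀ F b G → conv F (b ∷ᶠ G) ≗ λ k → b * F k + (0 ∷ᶠ conv F G) k
conv-unfoldʳ F b G zero    = trans (*-comm (F 0) b) (sym (+-identityʳ _))
conv-unfoldʳ F b G (suc k) = begin
  F 0 * G k + conv (F ∘ suc) (b ∷ᶠ G) k             ≡⟨ cong (F 0 * G k +_) (conv-unfoldʳ (F ∘ suc) b G k) ⟩
  F 0 * G k + (b * F (suc k) + (0 ∷ᶠ C′) k)  ≡⟨ x∙yz≈y∙xz (F 0 * G k) (b * F (suc k)) _ ⟩
  b * F (suc k) + (F 0 * G k + (0 ∷ᶠ C′) k)  ≡⟨ cong (b * F (suc k) +_) (conv-unfoldˡ F G k) ⟨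
  b * F (suc k) + conv F G k                  ∎
  where
    open ≡-Reasoning
    C′ : ℕ → ℕ
    C′ = conv (F ∘ suc) G

∷ᶠ-cong : ∀ b {F G} → F ≗ G → b ∷ᶠ F ≗ b ∷ᶠ G
∷ᶠ-cong b F≗G zero    = refl
∷ᶠ-cong b F≗G (suc k) = F≗G k

-- Coefficient lists, constant term first; trailing zeros make _≡_ too fine, hence _≈ₚ_.
Poly : Set
Poly = List ℕ

coeff : Poly → ℕ → ℕ
coeff []      = const 0
coeff (a ∷ f) = a ∷ᶠ coeff f

infixl 6 _+ₚ_
infixl 7 _*ₚ_ _·ₚ_

_+ₚ_ : Poly → Poly → Poly
[]      +ₚ g       = g
(a ∷ f) +ₚ []      = a ∷ f
(a ∷ f) +ₚ (b ∷ g) = a + b ∷ f +ₚ g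

_·ₚ_ : ℕ → Poly → Poly
a ·ₚ []      = []
a ·ₚ (b ∷ g) = a * b ∷ a ·ₚ g

_*ₚ_ : Poly → Poly → Poly
[]      *ₚ g = []
(a ∷ f) *ₚ g = a ·ₚ g +ₚ (0 ∷ f *ₚ g)

coeff-+ₚ : ∀ f g → coeff (f +ₚ g) ≗ λ k → coeff f k + coeff g k
coeff-+ₚ []      g       k       = refl
coeff-+ₚ (a ∷ f) []      k       = sym (+-identityʳ _)
coeff-+ₚ (a ∷ f) (b ∷ g) zero    = refl
coeff-+ₚ (a ∷ f) (b ∷ g) (suc k) = coeff-+ₚ f g k

coeff-·ₚ : ∀ a f → coeff (a ·ₚ f) ≗ λ k → a * coeff f k
coeff-·ₚ a []      k       = sym (*-zeroʳ a)
coeff-·ₚ a (b ∷ f) zero    = refl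
coeff-·ₚ a (b ∷ f) (suc k) = coeff-·ₚ a f k

coeff-*ₚ : ∀ f g → coeff (f *ₚ g) ≗ conv (coeff f) (coeff g)
coeff-*ₚ []      g k = sym (conv-zeroˡ (coeff g) k)
coeff-*ₚ (a ∷ f) g k = begin
  coeff (a ·ₚ g +ₚ (0 ∷ f *ₚ g)) k                  ≡⟨ coeff-+ₚ (a ·ₚ g) (0 ∷ f *ₚ g) k ⟩
  coeff (a ·ₚ g) k + (0 ∷ᶠ coeff (f *ₚ g)) k        ≡⟨ cong₂ _+_ (coeff-·ₚ a g k) (∷ᶠ-cong 0 (coeff-*ₚ f g) k) ⟩
  a * coeff g k + (0 ∷ᶠ conv (coeff f) (coeff g)) k ≡⟨ conv-unfoldˡ (a ∷ᶠ coeff f) (coeff g) k ⟨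
  conv (a ∷ᶠ coeff f) (coeff g) k                   ∎
  where open ≡-Reasoning

infix 4 _≈ₚ_
record _≈ₚ_ (f g : Poly) : Set where
  constructor coeffwise
  field coeff-≗ : coeff f ≗ coeff g
open _≈ₚ_

+ₚ-cong : ∀ {f f′ g g′} → f ≈ₚ f′ → g ≈ₚ g′ → f +ₚ g ≈ₚ f′ +ₚ g′
+ₚ-cong {f} {f′} {g} {g′} (coeffwise f≗f′) (coeffwise g≗g′) = coeffwise λ k →
  trans (coeff-+ₚ f g k) (trans (cong₂ _+_ (f≗f′ k) (g≗g′ k)) (sym (coeff-+ₚ f′ g′ k)))

+ₚ-assoc : ∀ f g h → (f +ₚ g) +ₚ h ≈ₚ f +ₚ (g +ₚ h)
+ₚ-assoc f g h = coeffwise λ k → begin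
  coeff ((f +ₚ g) +ₚ h) k               ≡⟨ coeff-+ₚ (f +ₚ g) h k ⟩
  coeff (f +ₚ g) k + coeff h k          ≡⟨ cong (_+ coeff h k) (coeff-+ₚ f g k) ⟩
  coeff f k + coeff g k + coeff h k     ≡⟨ +-assoc (coeff f k) _ _ ⟩
  coeff f k + (coeff g k + coeff h k)   ≡⟨ cong (coeff f k +_) (coeff-+ₚ g h k) ⟨
  coeff f k + coeff (g +ₚ h) k          ≡⟨ coeff-+ₚ f (g +ₚ h) k ⟨
  coeff (f +ₚ (g +ₚ h)) k               ∎
  where open ≡-Reasoning

+ₚ-comm : ∀ f g → f +ₚ g ≈ₚ g +ₚ f
+ₚ-comm f g = coeffwise λ k →
  trans (coeff-+ₚ f g k) (trans (+-comm (coeff f k) _) (sym (coeff-+ₚ g f k)))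

*ₚ-cong : ∀ {f f′ g g′} → f ≈ₚ f′ → g ≈ₚ g′ → f *ₚ g ≈ₚ f′ *ₚ g′
*ₚ-cong {f} {f′} {g} {g′} (coeffwise f≗f′) (coeffwise g≗g′) = coeffwise λ k →
  trans (coeff-*ₚ f g k) (trans (conv-cong f≗f′ g≗g′ k) (sym (coeff-*ₚ f′ g′ k)))

1ₚ : Poly
1ₚ = 1 ∷ []

*ₚ-identityˡ : ∀ g → 1ₚ *ₚ g ≈ₚ g
*ₚ-identityˡ g = coeffwise λ k → begin
  coeff (1 ·ₚ g +ₚ (0 ∷ [])) k          ≡⟨ coeff-+ₚ (1 ·ₚ g) (0 ∷ []) k ⟩
  coeff (1 ·ₚ g) k + (0 ∷ᶠ const 0) k   ≡⟨ cong₂ _+_ (coeff-·ₚ 1 g k) (∷ᶠ-zero k) ⟩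
  1 * coeff g k + 0                     ≡⟨ +-identityʳ _ ⟩
  1 * coeff g k                         ≡⟨ *-identityˡ _ ⟩
  coeff g k                             ∎
  where
    open ≡-Reasoning
    ∷ᶠ-zero : 0 ∷ᶠ const 0 ≗ const 0
    ∷ᶠ-zero zero    = refl
    ∷ᶠ-zero (suc k) = refl

*ₚ-∷ʳ : ∀ f b g → f *ₚ (b ∷ g) ≈ₚ b ·ₚ f +ₚ (0 ∷ f *ₚ g)
*ₚ-∷ʳ f b g = coeffwise λ k → begin
  coeff (f *ₚ (b ∷ g)) k                          ≡⟨ coeff-*ₚ f (b ∷ g) k ⟩
  conv (coeff f) (b ∷ᶠ coeff g) k                 ≡⟨ conv-unfoldʳ (coeff f) b (coeff g) k ⟩
  b * coeff f k + (0 ∷ᶠ conv (coeff f) (coeff g)) k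
    ≡⟨ cong₂ _+_ (coeff-·ₚ b f k) (∷ᶠ-cong 0 (coeff-*ₚ f g) k) ⟨
  coeff (b ·ₚ f) k + coeff (0 ∷ f *ₚ g) k         ≡⟨ coeff-+ₚ (b ·ₚ f) (0 ∷ f *ₚ g) k ⟨
  coeff (b ·ₚ f +ₚ (0 ∷ f *ₚ g)) k                ∎
  where open ≡-Reasoning

*ₚ-comm : ∀ f g → f *ₚ g ≈ₚ g *ₚ f
*ₚ-comm []      g = coeffwise λ k → sym (trans (coeff-*ₚ g [] k) (conv-zeroʳ (coeff g) k))
*ₚ-comm (a ∷ f) g = coeffwise λ k → begin
  coeff (a ·ₚ g +ₚ (0 ∷ f *ₚ g)) k            ≡⟨ coeff-+ₚ (a ·ₚ g) (0 ∷ f *ₚ g) k ⟩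
  coeff (a ·ₚ g) k + (0 ∷ᶠ coeff (f *ₚ g)) k  ≡⟨ cong (coeff (a ·ₚ g) k +_) (∷ᶠ-cong 0 (coeff-≗ (*ₚ-comm f g)) k) ⟩
  coeff (a ·ₚ g) k + (0 ∷ᶠ coeff (g *ₚ f)) k  ≡⟨ coeff-+ₚ (a ·ₚ g) (0 ∷ g *ₚ f) k ⟨
  coeff (a ·ₚ g +ₚ (0 ∷ g *ₚ f)) k            ≡⟨ coeff-≗ (*ₚ-∷ʳ g a f) k ⟨
  coeff (g *ₚ (a ∷ f)) k                      ∎
  where open ≡-Reasoning

*ₚ-distribʳ : ∀ h f g → (f +ₚ g) *ₚ h ≈ₚ f *ₚ h +ₚ g *ₚ h
*ₚ-distribʳ h f g = coeffwise λ k → begin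
  coeff ((f +ₚ g) *ₚ h) k                       ≡⟨ coeff-*ₚ (f +ₚ g) h k ⟩
  conv (coeff (f +ₚ g)) (coeff h) k             ≡⟨ conv-cong (coeff-+ₚ f g) (λ _ → refl) k ⟩
  conv (λ i → coeff f i + coeff g i) (coeff h) k ≡⟨ conv-distribʳ (coeff f) (coeff g) (coeff h) k ⟩
  conv (coeff f) (coeff h) k + conv (coeff g) (coeff h) k
    ≡⟨ cong₂ _+_ (coeff-*ₚ f h k) (coeff-*ₚ g h k) ⟨
  coeff (f *ₚ h) k + coeff (g *ₚ h) k           ≡⟨ coeff-+ₚ (f *ₚ h) (g *ₚ h) k ⟨
  coeff (f *ₚ h +ₚ g *ₚ h) k                    ∎
  where open ≡-Reasoning

*ₚ-assoc : ∀ f g h → (f *ₚ g) *ₚ h ≈ₚ f *ₚ (g *ₚ h)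
*ₚ-assoc []      g h = coeffwise λ _ → refl
*ₚ-assoc (a ∷ f) g h = coeffwise λ k → begin
  coeff ((a ·ₚ g +ₚ (0 ∷ f *ₚ g)) *ₚ h) k        ≡⟨ coeff-*ₚ (a ·ₚ g +ₚ (0 ∷ f *ₚ g)) h k ⟩
  conv (coeff (a ·ₚ g +ₚ (0 ∷ f *ₚ g))) (coeff h) k
    ≡⟨ conv-cong (λ i → trans (coeff-+ₚ (a ·ₚ g) _ i) (cong (_+ coeff (0 ∷ f *ₚ g) i) (coeff-·ₚ a g i)))
                 (λ _ → refl) k ⟩
  conv (λ i → a * coeff g i + coeff (0 ∷ f *ₚ g) i) (coeff h) k
    ≡⟨ conv-distribʳ (λ i → a * coeff g i) (coeff (0 ∷ f *ₚ g)) (coeff h) k ⟩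
  conv (λ i → a * coeff g i) (coeff h) k + conv (0 ∷ᶠ coeff (f *ₚ g)) (coeff h) k
    ≡⟨ cong₂ _+_ (conv-scaleˡ a (coeff g) (coeff h) k) (conv-unfoldˡ (0 ∷ᶠ coeff (f *ₚ g)) (coeff h) k) ⟩
  a * conv (coeff g) (coeff h) k + (0 + (0 ∷ᶠ conv (coeff (f *ₚ g)) (coeff h)) k)
    ≡⟨ cong₂ _+_ (cong (a *_) (coeff-*ₚ g h k)) (∷ᶠ-cong 0 tail k) ⟨
  a * coeff (g *ₚ h) k + coeff (0 ∷ f *ₚ (g *ₚ h)) k
    ≡⟨ cong (_+ coeff (0 ∷ f *ₚ (g *ₚ h)) k) (coeff-·ₚ a (g *ₚ h) k) ⟨
  coeff (a ·ₚ (g *ₚ h)) k + coeff (0 ∷ f *ₚ (g *ₚ h)) k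
    ≡⟨ coeff-+ₚ (a ·ₚ (g *ₚ h)) _ k ⟨
  coeff (a ·ₚ (g *ₚ h) +ₚ (0 ∷ f *ₚ (g *ₚ h))) k ∎
  where
    open ≡-Reasoning
    tail : coeff (f *ₚ (g *ₚ h)) ≗ conv (coeff (f *ₚ g)) (coeff h)
    tail i = trans (sym (coeff-≗ (*ₚ-assoc f g h) i)) (coeff-*ₚ (f *ₚ g) h i)

+ₚ-*ₚ-commutativeSemiring : CommutativeSemiring 0ℓ 0ℓ
+ₚ-*ₚ-commutativeSemiring = record
  { Carrier = Poly ; _≈_ = _≈ₚ_ ; _+_ = _+ₚ_ ; _*_ = _*ₚ_ ; 0# = [] ; 1# = 1ₚ
  ; isCommutativeSemiring = IsCommutativeSemiringˡ.isCommutativeSemiring record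
    { +-isCommutativeMonoid = isCommutativeMonoidˡ record
      { isSemigroup = record
        { isMagma = record { isEquivalence = ≈ₚ-isEquivalence ; ∙-cong = +ₚ-cong }
        ; assoc = +ₚ-assoc }
      ; identityˡ = λ _ → coeffwise λ _ → refl
      ; comm = +ₚ-comm }
    ; *-isCommutativeMonoid = isCommutativeMonoidˡ record
      { isSemigroup = record
        { isMagma = record { isEquivalence = ≈ₚ-isEquivalence ; ∙-cong = *ₚ-cong }
        ; assoc = *ₚ-assoc }
      ; identityˡ = *ₚ-identityˡ
      ; comm = *ₚ-comm }
    ; distribʳ = *ₚ-distribʳ
    ; zeroˡ = λ _ → coeffwise λ _ → refl }
  }
  where
    ≈ₚ-isEquivalence : IsEquivalence _≈ₚ_
    ≈ₚ-isEquivalence = record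
      { refl  = coeffwise λ _ → refl
      ; sym   = λ (coeffwise e) → coeffwise λ k → sym (e k)
      ; trans = λ (coeffwise e) (coeffwise e′) → coeffwise λ k → trans (e k) (e′ k) }

open CommutativeSemiring +ₚ-*ₚ-commutativeSemiring
  using (semiring; *-congʳ)
  renaming (refl to ≈ₚ-refl; sym to ≈ₚ-sym; trans to ≈ₚ-trans)
open import Algebra.Properties.Semiring.Exp semiring using (^-homo-*) renaming (_^_ to _^ₚ_)
open import Algebra.Properties.Semiring.Mult semiring using (×-assoc-*; ×1-homo-*) renaming (_×_ to _×ₚ_)
open Congruence +ₚ-*ₚ-commutativeSemiring

-- Binomial coefficients modulo p²

X : Poly
X = 0 ∷ 1 ∷ []

coeff-×ₚ : ∀ n f → coeff (n ×ₚ f) ≗ λ k → n * coeff f k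
coeff-×ₚ zero    f k = refl
coeff-×ₚ (suc n) f k = trans (coeff-+ₚ f (n ×ₚ f) k) (cong (coeff f k +_) (coeff-×ₚ n f k))

coeff-X*ₚ : ∀ h → coeff (X *ₚ h) ≗ 0 ∷ᶠ coeff h
coeff-X*ₚ h k = begin
  coeff (0 ·ₚ h +ₚ (0 ∷ 1ₚ *ₚ h)) k            ≡⟨ coeff-+ₚ (0 ·ₚ h) (0 ∷ 1ₚ *ₚ h) k ⟩
  coeff (0 ·ₚ h) k + (0 ∷ᶠ coeff (1ₚ *ₚ h)) k  ≡⟨ cong₂ _+_ (coeff-·ₚ 0 h k) (∷ᶠ-cong 0 (coeff-≗ (*ₚ-identityˡ h)) k) ⟩
  0 + (0 ∷ᶠ coeff h) k                         ∎
  where open ≡-Reasoning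

0∷ᶠshift : ∀ m g → 0 ∷ᶠ shift m g ≗ shift (suc m) g
0∷ᶠshift m g zero    = refl
0∷ᶠshift m g (suc k) = refl

coeff-X^m*ₚ : ∀ m h → coeff (X ^ₚ m *ₚ h) ≗ shift m (coeff h)
coeff-X^m*ₚ zero    h k = coeff-≗ (*ₚ-identityˡ h) k
coeff-X^m*ₚ (suc m) h k = begin
  coeff ((X *ₚ X ^ₚ m) *ₚ h) k     ≡⟨ coeff-≗ (*ₚ-assoc X (X ^ₚ m) h) k ⟩
  coeff (X *ₚ (X ^ₚ m *ₚ h)) k     ≡⟨ coeff-X*ₚ (X ^ₚ m *ₚ h) k ⟩
  (0 ∷ᶠ coeff (X ^ₚ m *ₚ h)) k     ≡⟨ ∷ᶠ-cong 0 (coeff-X^m*ₚ m h) k ⟩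
  (0 ∷ᶠ shift m (coeff h)) k       ≡⟨ 0∷ᶠshift m (coeff h) k ⟩
  shift (suc m) (coeff h) k        ∎
  where open ≡-Reasoning

coeff-[X+1]^n : ∀ n → coeff ((X +ₚ 1ₚ) ^ₚ n) ≗ n C_
coeff-[X+1]^n zero    zero    = refl
coeff-[X+1]^n zero    (suc k) = refl
coeff-[X+1]^n (suc n) k = begin
  coeff ((X +ₚ 1ₚ) *ₚ B^n) k                     ≡⟨ coeff-≗ (*ₚ-distribʳ B^n X 1ₚ) k ⟩
  coeff (X *ₚ B^n +ₚ 1ₚ *ₚ B^n) k                ≡⟨ coeff-+ₚ (X *ₚ B^n) (1ₚ *ₚ B^n) k ⟩
  coeff (X *ₚ B^n) k + coeff (1ₚ *ₚ B^n) k       ≡⟨ cong₂ _+_ (coeff-X*ₚ B^n k) (coeff-≗ (*ₚ-identityˡ B^n) k) ⟩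
  (0 ∷ᶠ coeff B^n) k + coeff B^n k               ≡⟨ cong₂ _+_ (∷ᶠ-cong 0 (coeff-[X+1]^n n) k) (coeff-[X+1]^n n k) ⟩
  (0 ∷ᶠ (n C_)) k + n C k                        ≡⟨ Pascal k ⟩
  suc n C k                                      ∎
  where
    open ≡-Reasoning
    B^n = (X +ₚ 1ₚ) ^ₚ n
    Pascal : ∀ k → (0 ∷ᶠ (n C_)) k + n C k ≡ suc n C k
    Pascal zero    = refl
    Pascal (suc k) = nCk+nC[k+1]≡[n+1]C[k+1] n k

coeff-≈mod-n² : ∀ {f g} n → f ≈ g mod (n ×ₚ 1ₚ) *ₚ (n ×ₚ 1ₚ) → ∀ k → Σ ℕ λ e → coeff f k ≡ coeff g k + n * n * e
coeff-≈mod-n² {f} {g} n (witness E f≈) k = coeff E k , (begin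
  coeff f k                                          ≡⟨ coeff-≗ f≈ k ⟩
  coeff (g +ₚ (N *ₚ N) *ₚ E) k                       ≡⟨ coeff-+ₚ g _ k ⟩
  coeff g k + coeff ((N *ₚ N) *ₚ E) k                ≡⟨ cong (coeff g k +_) (coeff-≗ NNE≈ k) ⟩
  coeff g k + coeff ((n * n) ×ₚ E) k                 ≡⟨ cong (coeff g k +_) (coeff-×ₚ (n * n) E k) ⟩
  coeff g k + n * n * coeff E k                      ∎)
  where
    open ≡-Reasoning
    N = n ×ₚ 1ₚ
    NNE≈ : (N *ₚ N) *ₚ E ≈ₚ (n * n) ×ₚ E
    NNE≈ = ≈ₚ-trans (*-congʳ (≈ₚ-sym (×1-homo-* n n))) (≈ₚ-sym (×≈×1#* (n * n) E))

coeff-sum*[X+1]^A : ∀ a n (c d : ℕ → ℕ) A K →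
  coeff (sumFromᴿ a n (λ k → c k ×ₚ X ^ₚ d k) *ₚ (X +ₚ 1ₚ) ^ₚ A) K ≡ sumFrom a n (λ k → c k * shift (d k) (A C_) K)
coeff-sum*[X+1]^A a zero    c d A K = refl
coeff-sum*[X+1]^A a (suc n) c d A K = begin
  coeff ((c a ×ₚ X ^ₚ d a +ₚ S) *ₚ B^A) K                 ≡⟨ coeff-≗ (*ₚ-distribʳ B^A (c a ×ₚ X ^ₚ d a) S) K ⟩
  coeff ((c a ×ₚ X ^ₚ d a) *ₚ B^A +ₚ S *ₚ B^A) K          ≡⟨ coeff-+ₚ ((c a ×ₚ X ^ₚ d a) *ₚ B^A) (S *ₚ B^A) K ⟩
  coeff ((c a ×ₚ X ^ₚ d a) *ₚ B^A) K + coeff (S *ₚ B^A) K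
    ≡⟨ cong₂ _+_ (coeff-≗ (×-assoc-* (c a) (X ^ₚ d a) B^A) K) (coeff-sum*[X+1]^A (suc a) n c d A K) ⟩
  coeff (c a ×ₚ (X ^ₚ d a *ₚ B^A)) K + sumFrom (suc a) n (λ k → c k * shift (d k) (A C_) K)
    ≡⟨ cong (_+ sumFrom (suc a) n (λ k → c k * shift (d k) (A C_) K)) (coeff-×ₚ (c a) (X ^ₚ d a *ₚ B^A) K) ⟩
  c a * coeff (X ^ₚ d a *ₚ B^A) K + sumFrom (suc a) n (λ k → c k * shift (d k) (A C_) K)
    ≡⟨ cong (λ z → c a * z + sumFrom (suc a) n (λ k → c k * shift (d k) (A C_) K))
            (trans (coeff-X^m*ₚ (d a) B^A K) (shift-cong (d a) (coeff-[X+1]^n A) K)) ⟩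
  c a * shift (d a) (A C_) K + sumFrom (suc a) n (λ k → c k * shift (d k) (A C_) K) ∎
  where
    open ≡-Reasoning
    B^A = (X +ₚ 1ₚ) ^ₚ A
    S = sumFromᴿ (suc a) n (λ k → c k ×ₚ X ^ₚ d k)

module _ {p} (pr : Prime p) (t : ℕ) where

  private
    B = X +ₚ 1ₚ

  C[A+pᵗ⁺¹]-expansion-via : ∀ (d : ℕ → ℕ)
    → (X ^ₚ (p ^ t) +ₚ 1ₚ) ^ₚ p ≈ₚ sumFromᴿ 0 (suc p) (λ k → (p C k) ×ₚ X ^ₚ d k)
    → ∀ A K → Σ ℕ λ e →
      (A + p ^ suc t) C K ≡ sumFrom 0 (suc p) (λ k → (p C k) * shift (d k) (A C_) K) + p * p * e
  C[A+pᵗ⁺¹]-expansion-via d binom A K =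
    let e , eq = coeff-≈mod-n² p B^A+pᵗ⁺¹≈ K in
    e , trans (sym (coeff-[X+1]^n (A + p ^ suc t) K))
          (trans eq (cong (_+ p * p * e) (coeff-sum*[X+1]^A 0 (suc p) (p C_) d A K)))
    where
      P = p ×ₚ 1ₚ
      B^A+pᵗ⁺¹≈ : B ^ₚ (A + p ^ suc t) ≈ sumFromᴿ 0 (suc p) (λ k → (p C k) ×ₚ X ^ₚ d k) *ₚ B ^ₚ A
                    mod P *ₚ P
      B^A+pᵗ⁺¹≈ =
        mod-trans (≈⇒≈mod (≈ₚ-trans (^-homo-* B A (p ^ suc t)) (*ₚ-comm (B ^ₚ A) (B ^ₚ (p ^ suc t)))))
        (mod-*-cong (mod-trans (frobenius-mod-p² pr X t) (≈⇒≈mod binom)) (≈⇒≈mod ≈ₚ-refl))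

  C[A+pᵗ⁺¹]-expansion : ∀ A K → Σ ℕ λ e →
    (A + p ^ suc t) C K ≡ sumFrom 0 (suc p) (λ k → (p C k) * shift (p ^ t * k) (A C_) K) + p * p * e
  C[A+pᵗ⁺¹]-expansion = C[A+pᵗ⁺¹]-expansion-via (λ k → p ^ t * k) (binomial-x^q+1 X (p ^ t) p)

  C[A+pᵗ⁺¹]-expansion-reversed : ∀ A K → Σ ℕ λ e →
    (A + p ^ suc t) C K ≡ sumFrom 0 (suc p) (λ k → (p C k) * shift (p ^ t * (p ∸ k)) (A C_) K) + p * p * e
  C[A+pᵗ⁺¹]-expansion-reversed = C[A+pᵗ⁺¹]-expansion-via (λ k → p ^ t * (p ∸ k)) (binomial-x^q+1-reversed X (p ^ t) p)

-- Evaluating the sums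

≡+*⇒≋ : ∀ {a b m} e → a ≡ b + m * e → a ≋ b [mod m ]
≡+*⇒≋ {b = b} {m} e refl = subst (λ z → m ∣ ℤ.∣ z ∣)
  (sym (trans (ℤ.[+m]-[+n]≡m⊖n (b + m * e) b) (ℤ.⊖-≥ (m≤m+n b (m * e)))))
  (subst (m ∣_) (sym (m+n∸m≡n b (m * e))) (m∣m*n e))

≋-cong : ∀ {a a′ b b′ m} → a ≡ a′ → b ≡ b′ → a ≋ b [mod m ] → a′ ≋ b′ [mod m ]
≋-cong refl refl a≋b = a≋b

shift-+ : ∀ m g k → shift m g (m + k) ≡ g k
shift-+ zero    g k = refl
shift-+ (suc m) g k = shift-+ m g k

shift-< : ∀ m g k → k < m → shift m g k ≡ 0
shift-< (suc m) g zero    _         = refl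
shift-< (suc m) g (suc k) (s≤s k<m) = shift-< m g k k<m

sumFrom-++ : ∀ a m n f → sumFrom a (m + n) f ≡ sumFrom a m f + sumFrom (a + m) n f
sumFrom-++ a zero    n f = cong (λ b → sumFrom b n f) (sym (+-identityʳ a))
sumFrom-++ a (suc m) n f = begin
  f a + sumFrom (suc a) (m + n) f                              ≡⟨ cong (f a +_) (sumFrom-++ (suc a) m n f) ⟩
  f a + (sumFrom (suc a) m f + sumFrom (suc a + m) n f)        ≡⟨ +-assoc (f a) _ _ ⟨
  f a + sumFrom (suc a) m f + sumFrom (suc a + m) n f          ≡⟨ cong (λ b → f a + sumFrom (suc a) m f + sumFrom b n f) (sym (+-suc a m)) ⟩
  f a + sumFrom (suc a) m f + sumFrom (a + suc m) n f          ∎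
  where open ≡-Reasoning

sumFrom-cong : ∀ a n {f g} → (∀ k → a ≤ k → k < a + n → f k ≡ g k) → sumFrom a n f ≡ sumFrom a n g
sumFrom-cong a zero    f≡g = refl
sumFrom-cong a (suc n) f≡g = cong₂ _+_ (f≡g a ≤-refl (m<m+n a (s≤s z≤n)))
  (sumFrom-cong (suc a) n λ k a<k k< → f≡g k (<⇒≤ a<k) (<-≤-trans k< (≤-reflexive (sym (+-suc a n)))))

sumFrom-zero : ∀ a n f → (∀ k → a ≤ k → k < a + n → f k ≡ 0) → sumFrom a n f ≡ 0
sumFrom-zero a zero    f f≡0 = refl
sumFrom-zero a (suc n) f f≡0 = cong₂ _+_ (f≡0 a ≤-refl (m<m+n a (s≤s z≤n)))
  (sumFrom-zero (suc a) n f λ k a<k k< → f≡0 k (<⇒≤ a<k) (<-≤-trans k< (≤-reflexive (sym (+-suc a n)))))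

sumFrom-restrict : ∀ {n a b} f g → a ≤ suc b → b < n
  → (∀ k → k < a → f k ≡ 0) → (∀ k → b < k → k < n → f k ≡ 0) → (∀ k → a ≤ k → k ≤ b → f k ≡ g k)
  → sumFrom 0 n f ≡ sumRange a b g
sumFrom-restrict {n} {a} {b} f g a≤b+1 b<n below above inside = begin
  sumFrom 0 n f                                          ≡⟨ cong (λ z → sumFrom 0 z f) n≡a+m+r ⟨
  sumFrom 0 (a + (m + r)) f                              ≡⟨ sumFrom-++ 0 a (m + r) f ⟩
  sumFrom 0 a f + sumFrom a (m + r) f                    ≡⟨ cong (sumFrom 0 a f +_) (sumFrom-++ a m r f) ⟩
  sumFrom 0 a f + (sumFrom a m f + sumFrom (a + m) r f)  ≡⟨ cong₂ _+_ head (cong₂ _+_ middle tail) ⟩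
  0 + (sumFrom a m g + 0)                                ≡⟨ +-identityʳ _ ⟩
  sumFrom a m g                                          ∎
  where
    open ≡-Reasoning
    m = suc b ∸ a
    r = n ∸ suc b
    a+m≡b+1 : a + m ≡ suc b
    a+m≡b+1 = m+[n∸m]≡n a≤b+1
    n≡a+m+r : a + (m + r) ≡ n
    n≡a+m+r = trans (sym (+-assoc a m r)) (trans (cong (_+ r) a+m≡b+1) (m+[n∸m]≡n b<n))
    head : sumFrom 0 a f ≡ 0
    head = sumFrom-zero 0 a f λ k _ k<a → below k k<a
    middle : sumFrom a m f ≡ sumFrom a m g
    middle = sumFrom-cong a m λ k a≤k k<a+m → inside k a≤k (<⇒≤pred (<-≤-trans k<a+m (≤-reflexive a+m≡b+1)))
    tail : sumFrom (a + m) r f ≡ 0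
    tail = sumFrom-zero (a + m) r f λ k a+m≤k k< →
      above k (<-≤-trans (≤-reflexive (sym a+m≡b+1)) a+m≤k)
              (<-≤-trans k< (≤-reflexive (trans (+-assoc a m r) n≡a+m+r)))

module _ {Q β : ℕ} (g : ℕ → ℕ) where

  shift-by-multiple : ∀ {k l} → k ≤ l → shift (Q * k) g (β + l * Q) ≡ g (β + (l ∸ k) * Q)
  shift-by-multiple {k} k≤l with m≤n⇒∃[o]m+o≡n k≤l
  ... | d , refl = begin
    shift (Q * k) g (β + (k + d) * Q)      ≡⟨ cong (shift (Q * k) g) (split β Q k d) ⟩
    shift (Q * k) g (Q * k + (β + d * Q))  ≡⟨ shift-+ (Q * k) g _ ⟩
    g (β + d * Q)                          ≡⟨ cong (λ z → g (β + z * Q)) (m+n∸m≡n k d) ⟨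
    g (β + (k + d ∸ k) * Q)                ∎
    where
      open ≡-Reasoning
      split : ∀ β Q k d → β + (k + d) * Q ≡ Q * k + (β + d * Q)
      split = solve-∀

  shift-by-multiple-vanishes : β < Q → ∀ {k l} → l < k → shift (Q * k) g (β + l * Q) ≡ 0
  shift-by-multiple-vanishes β<Q {k} {l} l<k = shift-< (Q * k) g (β + l * Q) (begin-strict
    β + l * Q    <⟨ +-monoˡ-< (l * Q) β<Q ⟩
    suc l * Q    ≤⟨ *-monoˡ-≤ Q l<k ⟩
    k * Q        ≡⟨ *-comm k Q ⟩
    Q * k        ∎)
    where open ≤-Reasoning

  shift-by-complement : ∀ {k n} l → k ≤ n → shift (Q * (n ∸ k)) g (β + l * Q + n * Q) ≡ g (β + (l + k) * Q)
  shift-by-complement {k} l k≤n with m≤n⇒∃[o]m+o≡n k≤n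
  ... | d , refl = begin
    shift (Q * (k + d ∸ k)) g (β + l * Q + (k + d) * Q)
      ≡⟨ cong (λ z → shift (Q * z) g (β + l * Q + (k + d) * Q)) (m+n∸m≡n k d) ⟩
    shift (Q * d) g (β + l * Q + (k + d) * Q)      ≡⟨ cong (shift (Q * d) g) (split β Q l k d) ⟩
    shift (Q * d) g (Q * d + (β + (l + k) * Q))    ≡⟨ shift-+ (Q * d) g _ ⟩
    g (β + (l + k) * Q)                            ∎
    where
      open ≡-Reasoning
      split : ∀ β Q l k d → β + l * Q + (k + d) * Q ≡ Q * d + (β + (l + k) * Q)
      split = solve-∀

*-nC0-identityʳ : ∀ x n → x * (n C 0) ≡ x
*-nC0-identityʳ x n = trans (cong (x *_) (trans (nCk≡nC[n∸k] {n = n} z≤n) (nCn≡1 n))) (*-identityʳ x)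

[α+rQ]C[β+jQ]≡0 : ∀ {α β Q r j} → α < Q → r < j → (α + r * Q) C (β + j * Q) ≡ 0
[α+rQ]C[β+jQ]≡0 {α} {β} {Q} {r} {j} α<Q r<j = k>n⇒nCk≡0 (begin-strict
  α + r * Q    <⟨ +-monoˡ-< (r * Q) α<Q ⟩
  suc r * Q    ≤⟨ *-monoˡ-≤ Q r<j ⟩
  j * Q        ≤⟨ m≤n+m (j * Q) β ⟩
  β + j * Q    ∎)
  where open ≤-Reasoning

module _ {p} (pr : Prime p) (t : ℕ) {α β : ℕ} (α<Q : α < p ^ t) (β<Q : β < p ^ t) (r l : ℕ) where

  private
    Q = p ^ t
    A = α + r * Q
    G H : ℕ → ℕ
    G j = (A C (β + (l ∸ j) * Q)) * (p C j)
    H j = (A C (β + (l + j) * Q)) * (p C j)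

  top-shift-congruence : l < p → (A + p ^ suc t) C (β + l * Q) ≋ sumRange (l ∸ r) l G [mod p * p ]
  top-shift-congruence l<p =
    let e , eq = C[A+pᵗ⁺¹]-expansion pr t A (β + l * Q) in
    ≡+*⇒≋ e (trans eq (cong (_+ p * p * e)
      (sumFrom-restrict f G (≤-trans (m∸n≤m l r) (n≤1+n l)) (s≤s (<⇒≤ l<p)) below above (λ k _ → inside k))))
    where
      f : ℕ → ℕ
      f k = (p C k) * shift (Q * k) (A C_) (β + l * Q)
      inside : ∀ k → k ≤ l → f k ≡ G k
      inside k k≤l = trans (cong ((p C k) *_) (shift-by-multiple {Q} {β} (A C_) k≤l)) (*-comm (p C k) _)
      below : ∀ k → k < l ∸ r → f k ≡ 0
      below k k<l∸r = trans (inside k k≤l) (cong (_* (p C k)) ([α+rQ]C[β+jQ]≡0 {β = β} α<Q r<l∸k))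
        where
          k≤l : k ≤ l
          k≤l = <⇒≤ (<-≤-trans k<l∸r (m∸n≤m l r))
          r<l∸k : r < l ∸ k
          r<l∸k = ∸-cancelʳ-< (subst (_< l ∸ r) (sym (m∸[m∸n]≡n k≤l)) k<l∸r)
      above : ∀ k → l < k → k < suc p → f k ≡ 0
      above k l<k _ = trans (cong ((p C k) *_) (shift-by-multiple-vanishes (A C_) β<Q l<k)) (*-zeroʳ (p C k))

  top-shift-congruence-l≤r : l ≤ r → l < p →
    (A + p ^ suc t) C (β + l * Q) ≋ A C (β + l * Q) + sumRange 1 l G [mod p * p ]
  top-shift-congruence-l≤r l≤r l<p = ≋-cong refl
    (trans (cong (λ a → sumRange a l G) (m≤n⇒m∸n≡0 l≤r))
           (cong (_+ sumRange 1 l G) (*-nC0-identityʳ (A C (β + l * Q)) p)))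
    (top-shift-congruence l<p)

  both-shift-congruence : r < p →
    (A + p ^ suc t) C (β + l * Q + p ^ suc t) ≋ A C (β + l * Q) + sumRange 1 (r ∸ l) H [mod p * p ]
  both-shift-congruence r<p =
    let e , eq = C[A+pᵗ⁺¹]-expansion-reversed pr t A (β + l * Q + p ^ suc t) in
    ≡+*⇒≋ e (trans eq (cong (_+ p * p * e) (trans
      (sumFrom-restrict f H z≤n (s≤s r∸l≤p) (λ _ ()) above (λ k _ k≤r∸l → inside k (≤-trans k≤r∸l r∸l≤p)))
      (cong (_+ sumRange 1 (r ∸ l) H) H0≡))))
    where
      H0≡ : H 0 ≡ A C (β + l * Q)
      H0≡ = trans (*-nC0-identityʳ (A C (β + (l + 0) * Q)) p) (cong (λ i → A C (β + i * Q)) (+-identityʳ l))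
      r∸l≤p : r ∸ l ≤ p
      r∸l≤p = ≤-trans (m∸n≤m r l) (<⇒≤ r<p)
      f : ℕ → ℕ
      f k = (p C k) * shift (Q * (p ∸ k)) (A C_) (β + l * Q + p ^ suc t)
      inside : ∀ k → k ≤ p → f k ≡ H k
      inside k k≤p = trans (cong ((p C k) *_) (shift-by-complement {Q} {β} (A C_) l k≤p)) (*-comm (p C k) _)
      above : ∀ k → r ∸ l < k → k < suc p → f k ≡ 0
      above k r∸l<k k<p+1 = trans (inside k (<⇒≤pred k<p+1)) (cong (_* (p C k)) ([α+rQ]C[β+jQ]≡0 {β = β} α<Q r<l+k))
        where
          r<l+k : r < l + k
          r<l+k = ≤-<-trans (m≤n+m∸n r l) (+-monoʳ-< l r∸l<k)

  both-shift-congruence-l≡r : l ≡ r → r < p →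
    (A + p ^ suc t) C (β + l * Q + p ^ suc t) ≋ A C (β + l * Q) [mod p * p ]
  both-shift-congruence-l≡r refl r<p = ≋-cong refl
    (trans (cong (λ n → A C (β + l * Q) + sumRange 1 n H) (n∸n≡0 l)) (+-identityʳ _))
    (both-shift-congruence r<p)

sumRange-singleton : ∀ a f → sumRange a a f ≡ f a
sumRange-singleton a f = trans (cong (λ n → sumFrom a n f) (m+n∸n≡m 1 a)) (+-identityʳ (f a))

top-shift-congruence-r≡0 : ∀ {p} → Prime p → ∀ t {α β l} → α < p ^ t → β < p ^ t → l < p →
  (α + p ^ suc t) C (β + l * p ^ t) ≋ (α C β) * (p C l) [mod p * p ]
top-shift-congruence-r≡0 {p} pr t {α} {β} {l} α<Q β<Q l<p =
  ≋-cong (cong (λ a → (a + p ^ suc t) C (β + l * p ^ t)) (+-identityʳ α)) single-term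
    (top-shift-congruence pr t α<Q β<Q 0 l l<p)
  where
    single-term : sumRange l l (λ j → ((α + 0 * p ^ t) C (β + (l ∸ j) * p ^ t)) * (p C j)) ≡ (α C β) * (p C l)
    single-term = trans (sumRange-singleton l _) (cong₂ (λ a b → (a C b) * (p C l)) (+-identityʳ α)
      (trans (cong (λ i → β + i * p ^ t) (n∸n≡0 l)) (+-identityʳ β)))

lemma3p2 : (p s α β r l : ℕ) → Prime p → 2 ≤ s
    → α < p ^ (s ∸ 1) → β < p ^ (s ∸ 1)
    → 1 ≤ r → r < p → 1 ≤ l → l < p
    → ((α + p ^ s) C (β + l * p ^ (s ∸ 1)) ≋ (α C β) * (p C l) [mod p * p ])
      × (l ≤ r → (α + r * p ^ (s ∸ 1) + p ^ s) C (β + l * p ^ (s ∸ 1))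
           ≋ (α + r * p ^ (s ∸ 1)) C (β + l * p ^ (s ∸ 1))
             + sumRange 1 l (λ j → ((α + r * p ^ (s ∸ 1)) C (β + (l ∸ j) * p ^ (s ∸ 1))) * (p C j))
           [mod p * p ])
      × (l > r → (α + r * p ^ (s ∸ 1) + p ^ s) C (β + l * p ^ (s ∸ 1))
           ≋ sumRange (l ∸ r) l (λ j → ((α + r * p ^ (s ∸ 1)) C (β + (l ∸ j) * p ^ (s ∸ 1))) * (p C j))
           [mod p * p ])
      × (l < r → (α + r * p ^ (s ∸ 1) + p ^ s) C (β + l * p ^ (s ∸ 1) + p ^ s)
           ≋ (α + r * p ^ (s ∸ 1)) C (β + l * p ^ (s ∸ 1))
             + sumRange 1 (r ∸ l) (λ j → ((α + r * p ^ (s ∸ 1)) C (β + (l + j) * p ^ (s ∸ 1))) * (p C j))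
           [mod p * p ])
      × (l ≡ r → (α + r * p ^ (s ∸ 1) + p ^ s) C (β + l * p ^ (s ∸ 1) + p ^ s)
           ≋ (α + r * p ^ (s ∸ 1)) C (β + l * p ^ (s ∸ 1))
           [mod p * p ])
lemma3p2 p .(suc t) α β r l pr (s≤s {n = t} _) α<Q β<Q _ r<p _ l<p =
    top-shift-congruence-r≡0 pr t α<Q β<Q l<p
  , (λ l≤r → top-shift-congruence-l≤r pr t α<Q β<Q r l l≤r l<p)
  , (λ _ → top-shift-congruence pr t α<Q β<Q r l l<p)
  , (λ _ → both-shift-congruence pr t α<Q β<Q r l r<p)
  , (λ l≡r → both-shift-congruence-l≡r pr t α<Q β<Q r l l≡r r<p)
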